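{- Let $C$ be a reachable command, $(s,h,\rho)$ a state with $\rho=(O,L,D)$, $Q$ an assertion, $A\subseteq\mathbf{Var}$, $\Gamma$ a resource context and $r,r'$ resource names such that $r'\notin Res(C)$, $r'\notin Res(\Gamma)$ and $O\cup L\cup D=Res(\Gamma)$. If $\mathit{Safe}_n(C[r'/r],s,h,\rho[r'/r],\Gamma[r'/r],Q,A)$ holds, then $\mathit{Safe}_n(C,s,h,\rho,\Gamma,Q,A)$ holds.
   Context: Stores $s:\mathbf{Var}\to\mathbf{Val}$; finite partial heaps; separation-logic assertions with standard satisfaction; $h\bot g$ disjoint domains, $h\uplus g$ union. A resource context is a list $r_1(X_1):R_1,\dots,r_n(X_n):R_n$ (distinct resource names, $X_i\subseteq\mathbf{Var}$, precise $R_i$ with $FV(R_i)\subseteq X_i$); $Res(\Gamma)=\{r_i\}$, $PV(r_i)=X_i$, $\Gamma(r_i)=R_i$, $\circledast_{r\in D}\Gamma(r)$ separating conjunction over $D$ ($\texttt{emp}$ if empty); $\Gamma[r'/r]$ renames $r$ to $r'$. Resource configuration: triple $(O,L,D)$ of pairwise disjoint sets of resource names; $r\in\rho$ iff $r\in O\cup L\cup D$; $\rho\setminus\{r\}$ componentwise removal; $\rho[r'/r]$ componentwise renaming. A state is $(s,h,\rho)$. Commands: $\mathsf{skip}$, basic commands $x:=e$, $x:=[e]$, $[e]:=e'$, $x:=\mathsf{cons}(\dots)$, $\mathsf{dispose}(e)$ (standard semantics $[c](s,h)$, pair or $\mathsf{abort}$), $C_1;C_2$, $\mathsf{if}$, $\mathsf{while}$,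 $\mathsf{resource}\ r\ \mathsf{in}\ C$, $\mathsf{with}\ r\ \mathsf{when}\ B\ \mathsf{do}\ C$, $C_1\|C_2$ (unextended), and $\mathsf{within}\ r\ \mathsf{do}\ C$. $Res(C)$: resource names occurring in $C$; $C[r'/r]$ renaming. $Locked(C_1;C_2)=Locked(C_1)$, $Locked(C_1\|C_2)=Locked(C_1)\cup Locked(C_2)$, $Locked(\mathsf{resource}\ r\ \mathsf{in}\ C)=Locked(C)\setminus\{r\}$, $Locked(\mathsf{within}\ r\ \mathsf{do}\ C)=Locked(C)\cup\{r\}$, else $\emptyset$. Program transitions $\to_p$: (S1) $\mathsf{skip};C_2\to C_2$; (S2) $C_1;C_2$ steps via $C_1$; (LP) while unfolds to $\mathsf{if}\ B\ \mathsf{then}\ (C;\mathsf{while}\ B\ \mathsf{do}\ C)\ \mathsf{else}\ \mathsf{skip}$; (IF1/IF2) by $s(B)$; (P1/P2) a parallel component steps; (P3) $\mathsf{skip}\|\mathsf{skip}\to\mathsf{skip}$; (R0) $\mathsf{resource}\ r\ \mathsf{in}\ \mathsf{skip}\to\mathsf{skip}$ if $r\notin\rho$; (R1) if $r\notin\rho=(O,L,D)$, $r\in Locked(C)$, $C,(s,h,(O\cup\{r\},L,D))\to_pC',(s',h',\rho')$ then $\mathsf{resource}\ r\ \mathsf{in}\ C,(s,h,\rho)\to_p\mathsf{resource}\ r\ \mathsf{in}\ C',(s',h',\rho'\setminus\{r\})$; (R2) same with $r\notin Locked(C)$ and $(O,L,D\cup\{r\})$; (W0) $\mathsf{with}\ r\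 \mathsf{when}\ B\ \mathsf{do}\ C,(s,h,(O,L,D\cup\{r\}))\to_p\mathsf{within}\ r\ \mathsf{do}\ C,(s,h,(O\cup\{r\},L,D))$ if $s(B)=\texttt{true}$; (W1) if $r\in O$ and $C,(s,h,(O\setminus\{r\},L,D))\to_pC',(s',h',(O',L',D'))$ then $\mathsf{within}\ r\ \mathsf{do}\ C,(s,h,(O,L,D))\to_p\mathsf{within}\ r\ \mathsf{do}\ C',(s',h',(O'\cup\{r\},L',D'))$; (W2) $\mathsf{within}\ r\ \mathsf{do}\ \mathsf{skip},(s,h,(O\cup\{r\},L,D))\to_p\mathsf{skip},(s,h,(O,L,D\cup\{r\}))$; (BCT) $c,(s,h,\rho)\to_p\mathsf{skip},(s',h',\rho)$ if $[c](s,h)=(s',h')$. Abort: (RA) $\mathsf{resource}\ r$ with $r\in\rho$; (WA) $\mathsf{with}\ r$ with $r\notin\rho$; (RA1)/(RA2) body aborts under the configurations of (R1)/(R2); (BCA) $[c](s,h)=\mathsf{abort}$; (SA) first component of $;$ aborts; (WA1) body of $\mathsf{within}\ r$ aborts under $\rho\setminus\{r\}$; (WA2) $\mathsf{within}\ r$ with $r\notin O$; (PA1/PA2) a component of $\|$ aborts. A command is reachable if for some unextended $C_0$ there are states $\sigma,\sigma'$ and $k$ with $C_0,\sigma\to_p^kC',\sigma'$ and $C_0,\sigma\not\to_p^j\mathsf{abort}$ for $j\le k$. Environment: $(s,h,(O,L,D))\stackrel{A}{\leftrightsquigarrow}(s',h,(O,L',D'))$ iff $s(x)=s'(x)$ for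 $x\in A$ and $L'\cup D'=L\cup D$; with $A'=A\cup\bigcup_{r\in Locked(C)}PV(r)$, if $(s,h,\rho)\stackrel{A'}{\leftrightsquigarrow}(s',h,\rho')$, $\rho=(O,L,D)$, $\rho'=(O,L',D')$, $s,h_G\models\circledast_{r\in D}\Gamma(r)$, $s',h'_G\models\circledast_{r\in D'}\Gamma(r)$, then $C,(s,h\uplus h_G,\rho)\xrightarrow{A,\Gamma}_eC,(s',h\uplus h'_G,\rho')$; $\xrightarrow{A,\Gamma}=\to_p\cup\xrightarrow{A,\Gamma}_e$. $chng(C)$: variables $x$ such that the next transition of $C$ can execute $x:=e$, $x:=[e]$ or $x:=\mathsf{cons}(\dots)$. Safety: $\mathit{Safe}_0$ always holds; $\mathit{Safe}_{n+1}(C,s,h,\rho,\Gamma,Q,A)$, $\rho=(O,L,D)$, iff (i) $C=\mathsf{skip}\Rightarrow s,h\models Q$; (ii) $C,(s,h,\rho)\not\to_p\mathsf{abort}$; (iii) $chng(C)\cap\bigcup_{r\in L\cup D}PV(r)=\emptyset$; (iv) for every $h_G\bot h$ with $s,h_G\models\circledast_{r\in D}\Gamma(r)$ and every $C,(s,h\uplus h_G,\rho)\xrightarrow{A,\Gamma}C',(s',\hat h,\rho')$, $\rho'=(O',L',D')$, there exist $h',h'_G$ with $\hat h=h'\uplus h'_G$, $s',h'_G\models\circledast_{r\in D'}\Gamma(r)$ and $\mathit{Safe}_n(C',s',h',\rho',\Gamma,Q,A)$. -}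

module Defs where

open import Data.Nat as ℕ using (ℕ; zero; suc)
open import Data.Integer as ℤ using (ℤ)
import Data.Integer.Properties as ℤP
import Data.Nat.Properties as ℕP
open import Data.Bool using (Bool; true; false; if_then_else_; not; _∧_; _∨_)
open import Data.Maybe using (Maybe; just; nothing)
open import Data.List using (List; []; _∷_; _++_; map; filter; length)
open import Data.List.Membership.Propositional using (_∈_; _∉_)
open import Data.List.Membership.Propositional.Properties using (∈-++⁺ˡ; ∈-++⁺ʳ)
open import Data.List.Relation.Unary.Any using (Any; here; there)
open import Data.List.Relation.Unary.Unique.Propositional using (Unique)
import Data.List.Membership.DecPropositional as DecMem
open import Data.Product using (Σ; _×_; _,_; proj₁; proj₂)
open import Data.Sum using (_⊎_)
open import Data.Empty using (⊥)
open import Data.Unit using (⊤)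
open import Data.Unit.Polymorphic using () renaming (⊤ to ⊤₁)
open import Relation.Nullary using (¬_; does; ¬?; yes; no)
open import Relation.Binary.PropositionalEquality using (_≡_; refl)

Var : Set
Var = ℕ

Val : Set
Val = ℤ

Loc : Set
Loc = ℤ

VarSet : Set₁
VarSet = Var → Set

Store : Set
Store = Var → Val

_[_↦_] : Store → Var → Val → Store
(s [ x ↦ v ]) y = if does (y ℕ.≟ x) then v else s y

record Heap : Set where
  field
    at  : Loc → Maybe Val
    fin : Σ (List Loc) λ xs → ∀ l v → at l ≡ just v → l ∈ xs
open Heap public

_≈H_ : Heap → Heap → Set
h₁ ≈H h₂ = ∀ l → at h₁ l ≡ at h₂ l

_⊥H_ : Heap → Heap → Set
h₁ ⊥H h₂ = ∀ l → at h₁ l ≡ nothing ⊎ at h₂ l ≡ nothing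

_⊆H_ : Heap → Heap → Set
h₁ ⊆H h₂ = ∀ l v → at h₁ l ≡ just v → at h₂ l ≡ just v

emptyH : Heap
emptyH = record { at = λ _ → nothing ; fin = [] , λ { l v () } }

-- union (meaningful as h ⊎ g when h ⊥ g)
_⊎H_ : Heap → Heap → Heap
h₁ ⊎H h₂ = record { at = f ; fin = proj₁ (fin h₁) ++ proj₁ (fin h₂) , pf }
  where
  f : Loc → Maybe Val
  f l with at h₁ l
  ... | just v  = just v
  ... | nothing = at h₂ l
  pf : ∀ l v → f l ≡ just v → l ∈ proj₁ (fin h₁) ++ proj₁ (fin h₂)
  pf l v e with at h₁ l in eq
  ... | just w  = ∈-++⁺ˡ (proj₂ (fin h₁) l w eq)
  ... | nothing = ∈-++⁺ʳ (proj₁ (fin h₁)) (proj₂ (fin h₂) l v e)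

updH : Heap → Loc → Val → Heap
updH h l v = record { at = f ; fin = l ∷ proj₁ (fin h) , pf }
  where
  f : Loc → Maybe Val
  f l' = if does (l' ℤ.≟ l) then just v else at h l'
  pf : ∀ l' w → f l' ≡ just w → l' ∈ l ∷ proj₁ (fin h)
  pf l' w e with l' ℤ.≟ l
  ... | yes p = here p
  ... | no _  = there (proj₂ (fin h) l' w e)

delH : Heap → Loc → Heap
delH h l = record { at = f ; fin = proj₁ (fin h) , pf }
  where
  f : Loc → Maybe Val
  f l' = if does (l' ℤ.≟ l) then nothing else at h l'
  pf : ∀ l' w → f l' ≡ just w → l' ∈ proj₁ (fin h)
  pf l' w e with l' ℤ.≟ l
  ... | yes _ = Data.Empty.⊥-elim (nj e)
    where
    import Data.Empty
    nj : nothing ≡ just w → ⊥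
    nj ()
  ... | no _  = proj₂ (fin h) l' w e

allocH : Heap → Loc → List Val → Heap
allocH h l []       = h
allocH h l (v ∷ vs) = updH (allocH h (l ℤ.+ ℤ.1ℤ) vs) l v

data Exp : Set where
  var   : Var → Exp
  lit   : ℤ → Exp
  plus  : Exp → Exp → Exp
  minus : Exp → Exp → Exp
  times : Exp → Exp → Exp

data BExp : Set where
  btrue bfalse : BExp
  eq le        : Exp → Exp → BExp
  bnot         : BExp → BExp
  band bor     : BExp → BExp → BExp

⟦_⟧ : Exp → Store → Val
⟦ var x ⟧ s       = s x
⟦ lit n ⟧ s       = n
⟦ plus e₁ e₂ ⟧ s  = ⟦ e₁ ⟧ s ℤ.+ ⟦ e₂ ⟧ s
⟦ minus e₁ e₂ ⟧ s = ⟦ e₁ ⟧ s ℤ.- ⟦ e₂ ⟧ s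
⟦ times e₁ e₂ ⟧ s = ⟦ e₁ ⟧ s ℤ.* ⟦ e₂ ⟧ s

⟦_⟧B : BExp → Store → Bool
⟦ btrue ⟧B s      = true
⟦ bfalse ⟧B s     = false
⟦ eq e₁ e₂ ⟧B s   = does (⟦ e₁ ⟧ s ℤ.≟ ⟦ e₂ ⟧ s)
⟦ le e₁ e₂ ⟧B s   = ⟦ e₁ ⟧ s ℤ.≤ᵇ ⟦ e₂ ⟧ s
⟦ bnot b ⟧B s     = not (⟦ b ⟧B s)
⟦ band b₁ b₂ ⟧B s = ⟦ b₁ ⟧B s ∧ ⟦ b₂ ⟧B s
⟦ bor b₁ b₂ ⟧B s  = ⟦ b₁ ⟧B s ∨ ⟦ b₂ ⟧B s

FreeE : Var → Exp → Set
FreeE x (var y)       = x ≡ y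
FreeE x (lit _)       = ⊥
FreeE x (plus e₁ e₂)  = FreeE x e₁ ⊎ FreeE x e₂
FreeE x (minus e₁ e₂) = FreeE x e₁ ⊎ FreeE x e₂
FreeE x (times e₁ e₂) = FreeE x e₁ ⊎ FreeE x e₂

FreeB : Var → BExp → Set
FreeB x btrue        = ⊥
FreeB x bfalse       = ⊥
FreeB x (eq e₁ e₂)   = FreeE x e₁ ⊎ FreeE x e₂
FreeB x (le e₁ e₂)   = FreeE x e₁ ⊎ FreeE x e₂
FreeB x (bnot b)     = FreeB x b
FreeB x (band b₁ b₂) = FreeB x b₁ ⊎ FreeB x b₂
FreeB x (bor b₁ b₂)  = FreeB x b₁ ⊎ FreeB x b₂

data Assn : Set where
  pure       : BExp → Assn
  emp        : Assn
  _↦_        : Exp → Exp → Assn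
  _⋆_        : Assn → Assn → Assn
  _-⋆_       : Assn → Assn → Assn
  _∧A_ _∨A_ _⇒A_ : Assn → Assn → Assn
  ∃A ∀A      : Var → Assn → Assn

_⊨_ : Store × Heap → Assn → Set
(s , h) ⊨ pure b    = ⟦ b ⟧B s ≡ true
(s , h) ⊨ emp       = ∀ l → at h l ≡ nothing
(s , h) ⊨ (e ↦ e')  = (at h (⟦ e ⟧ s) ≡ just (⟦ e' ⟧ s))
                      × (∀ l → ¬ (l ≡ ⟦ e ⟧ s) → at h l ≡ nothing)
(s , h) ⊨ (P ⋆ Q)   = Σ Heap λ h₁ → Σ Heap λ h₂ →
                      h₁ ⊥H h₂ × h ≈H (h₁ ⊎H h₂) × (s , h₁) ⊨ P × (s , h₂) ⊨ Q
(s , h) ⊨ (P -⋆ Q)  = ∀ h' → h' ⊥H h → (s , h') ⊨ P → (s , h ⊎H h') ⊨ Q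
(s , h) ⊨ (P ∧A Q)  = (s , h) ⊨ P × (s , h) ⊨ Q
(s , h) ⊨ (P ∨A Q)  = (s , h) ⊨ P ⊎ (s , h) ⊨ Q
(s , h) ⊨ (P ⇒A Q)  = (s , h) ⊨ P → (s , h) ⊨ Q
(s , h) ⊨ ∃A x P    = Σ Val λ v → (s [ x ↦ v ] , h) ⊨ P
(s , h) ⊨ ∀A x P    = ∀ v → (s [ x ↦ v ] , h) ⊨ P

FreeA : Var → Assn → Set
FreeA x (pure b)  = FreeB x b
FreeA x emp       = ⊥
FreeA x (e ↦ e')  = FreeE x e ⊎ FreeE x e'
FreeA x (P ⋆ Q)   = FreeA x P ⊎ FreeA x Q
FreeA x (P -⋆ Q)  = FreeA x P ⊎ FreeA x Q
FreeA x (P ∧A Q)  = FreeA x P ⊎ FreeA x Q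
FreeA x (P ∨A Q)  = FreeA x P ⊎ FreeA x Q
FreeA x (P ⇒A Q)  = FreeA x P ⊎ FreeA x Q
FreeA x (∃A y P)  = ¬ (x ≡ y) × FreeA x P
FreeA x (∀A y P)  = ¬ (x ≡ y) × FreeA x P

Precise : Assn → Set
Precise R = ∀ s h h₁ h₂ → h₁ ⊆H h → h₂ ⊆H h →
            (s , h₁) ⊨ R → (s , h₂) ⊨ R → h₁ ≈H h₂

ResName : Set
ResName = ℕ

open DecMem ℕ._≟_ using (_∈?_)

ren : ResName → ResName → ResName → ResName
ren r' r n = if does (n ℕ.≟ r) then r' else n

rm : ResName → List ResName → List ResName
rm r = filter (λ y → ¬? (y ℕ.≟ r))

record Entry : Set₁ where
  constructor entry
  field
    name : ResName
    prot : VarSet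
    inv  : Assn
open Entry public

Ctx : Set₁
Ctx = List Entry

ResΓ : Ctx → List ResName
ResΓ Γ = map name Γ

IsResCtx : Ctx → Set₁
IsResCtx Γ = Unique (ResΓ Γ)
           × (∀ e → e ∈ Γ → Precise (inv e) × (∀ x → FreeA x (inv e) → prot e x))

PV : Ctx → ResName → Var → Set₁
PV Γ r x = Any (λ e → name e ≡ r × prot e x) Γ

renΓ : ResName → ResName → Ctx → Ctx
renΓ r' r = map (λ e → entry (ren r' r (name e)) (prot e) (inv e))

Star : Store → Heap → Ctx → List ResName → Set
Star s h []      D = (s , h) ⊨ emp
Star s h (e ∷ Γ) D =
  if does (name e ∈? D)
  then (Σ Heap λ h₁ → Σ Heap λ h₂ →
          h₁ ⊥H h₂ × h ≈H (h₁ ⊎H h₂) × (s , h₁) ⊨ inv e × Star s h₂ Γ D)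
  else Star s h Γ D

record Config : Set where
  constructor cfg
  field
    O L D : List ResName
open Config public

_∈ρ_ : ResName → Config → Set
r ∈ρ ρ = r ∈ O ρ ⊎ r ∈ L ρ ⊎ r ∈ D ρ

ValidConfig : Config → Set
ValidConfig (cfg O L D) = ∀ r → (r ∈ O → r ∈ L → ⊥) × (r ∈ O → r ∈ D → ⊥) × (r ∈ L → r ∈ D → ⊥)

rmρ : ResName → Config → Config
rmρ r (cfg O L D) = cfg (rm r O) (rm r L) (rm r D)

renρ : ResName → ResName → Config → Config
renρ r' r (cfg O L D) = cfg (map (ren r' r) O) (map (ren r' r) L) (map (ren r' r) D)

_≐_ : List ResName → List ResName → Set
xs ≐ ys = ∀ r → (r ∈ xs → r ∈ ys) × (r ∈ ys → r ∈ xs)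

data Basic : Set where
  assign  : Var → Exp → Basic
  load    : Var → Exp → Basic
  store   : Exp → Exp → Basic
  consC   : Var → List Exp → Basic
  dispose : Exp → Basic

data Cmd : Set where
  skip     : Cmd
  basic    : Basic → Cmd
  _︔_      : Cmd → Cmd → Cmd
  ifte     : BExp → Cmd → Cmd → Cmd
  while    : BExp → Cmd → Cmd
  resource : ResName → Cmd → Cmd
  with'    : ResName → BExp → Cmd → Cmd
  _∥_      : Cmd → Cmd → Cmd
  within   : ResName → Cmd → Cmd

Unextended : Cmd → Set
Unextended skip             = ⊤
Unextended (basic _)        = ⊤
Unextended (C₁ ︔ C₂)        = Unextended C₁ × Unextended C₂
Unextended (ifte _ C₁ C₂)   = Unextended C₁ × Unextended C₂
Unextended (while _ C)      = Unextended C
Unextended (resource _ C)   = Unextended C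
Unextended (with' _ _ C)    = Unextended C
Unextended (C₁ ∥ C₂)        = Unextended C₁ × Unextended C₂
Unextended (within _ _)     = ⊥

ResC : ResName → Cmd → Set
ResC r skip            = ⊥
ResC r (basic _)       = ⊥
ResC r (C₁ ︔ C₂)       = ResC r C₁ ⊎ ResC r C₂
ResC r (ifte _ C₁ C₂)  = ResC r C₁ ⊎ ResC r C₂
ResC r (while _ C)     = ResC r C
ResC r (resource r' C) = r ≡ r' ⊎ ResC r C
ResC r (with' r' _ C)  = r ≡ r' ⊎ ResC r C
ResC r (C₁ ∥ C₂)       = ResC r C₁ ⊎ ResC r C₂
ResC r (within r' C)   = r ≡ r' ⊎ ResC r C

renC : ResName → ResName → Cmd → Cmd
renC r' r skip           = skip
renC r' r (basic c)      = basic c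
renC r' r (C₁ ︔ C₂)      = renC r' r C₁ ︔ renC r' r C₂
renC r' r (ifte b C₁ C₂) = ifte b (renC r' r C₁) (renC r' r C₂)
renC r' r (while b C)    = while b (renC r' r C)
renC r' r (resource n C) = resource (ren r' r n) (renC r' r C)
renC r' r (with' n b C)  = with' (ren r' r n) b (renC r' r C)
renC r' r (C₁ ∥ C₂)      = renC r' r C₁ ∥ renC r' r C₂
renC r' r (within n C)   = within (ren r' r n) (renC r' r C)

Locked : Cmd → List ResName
Locked (C₁ ︔ C₂)      = Locked C₁
Locked (C₁ ∥ C₂)      = Locked C₁ ++ Locked C₂
Locked (resource r C) = rm r (Locked C)
Locked (within r C)   = r ∷ Locked C
Locked _              = []

Chng : Var → Cmd → Set
Chng x (basic (assign y _)) = x ≡ y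
Chng x (basic (load y _))   = x ≡ y
Chng x (basic (consC y _))  = x ≡ y
Chng x (C₁ ︔ C₂)           = Chng x C₁
Chng x (C₁ ∥ C₂)            = Chng x C₁ ⊎ Chng x C₂
Chng x (resource _ C)       = Chng x C
Chng x (within _ C)         = Chng x C
Chng x _                    = ⊥

-- Semantics of basic commands (relational: cons is nondeterministic)

data BasicStep : Basic → Store → Heap → Store → Heap → Set where
  b-assign : ∀ {x e s h} → BasicStep (assign x e) s h (s [ x ↦ ⟦ e ⟧ s ]) h
  b-load   : ∀ {x e s h v} → at h (⟦ e ⟧ s) ≡ just v →
             BasicStep (load x e) s h (s [ x ↦ v ]) h
  b-store  : ∀ {e e' s h v} → at h (⟦ e ⟧ s) ≡ just v →
             BasicStep (store e e') s h s (updH h (⟦ e ⟧ s) (⟦ e' ⟧ s))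
  b-cons   : ∀ {x es s h} (l : Loc) →
             (∀ i → i ℕ.< length es → at h (l ℤ.+ ℤ.+ i) ≡ nothing) →
             BasicStep (consC x es) s h (s [ x ↦ l ]) (allocH h l (map (λ e → ⟦ e ⟧ s) es))
  b-dispose : ∀ {e s h v} → at h (⟦ e ⟧ s) ≡ just v →
             BasicStep (dispose e) s h s (delH h (⟦ e ⟧ s))

data BasicAbort : Basic → Store → Heap → Set where
  a-load    : ∀ {x e s h} → at h (⟦ e ⟧ s) ≡ nothing → BasicAbort (load x e) s h
  a-store   : ∀ {e e' s h} → at h (⟦ e ⟧ s) ≡ nothing → BasicAbort (store e e') s h
  a-dispose : ∀ {e s h} → at h (⟦ e ⟧ s) ≡ nothing → BasicAbort (dispose e) s h

State : Set
State = Store × Heap × Config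

data Step : Cmd → State → Cmd → State → Set where
  S1  : ∀ {C₂ σ} → Step (skip ︔ C₂) σ C₂ σ
  S2  : ∀ {C₁ C₁' C₂ σ σ'} → Step C₁ σ C₁' σ' → Step (C₁ ︔ C₂) σ (C₁' ︔ C₂) σ'
  LP  : ∀ {B C σ} → Step (while B C) σ (ifte B (C ︔ while B C) skip) σ
  IF1 : ∀ {B C₁ C₂ s h ρ} → ⟦ B ⟧B s ≡ true →
        Step (ifte B C₁ C₂) (s , h , ρ) C₁ (s , h , ρ)
  IF2 : ∀ {B C₁ C₂ s h ρ} → ⟦ B ⟧B s ≡ false →
        Step (ifte B C₁ C₂) (s , h , ρ) C₂ (s , h , ρ)
  P1  : ∀ {C₁ C₁' C₂ σ σ'} → Step C₁ σ C₁' σ' → Step (C₁ ∥ C₂) σ (C₁' ∥ C₂) σ'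
  P2  : ∀ {C₁ C₂ C₂' σ σ'} → Step C₂ σ C₂' σ' → Step (C₁ ∥ C₂) σ (C₁ ∥ C₂') σ'
  P3  : ∀ {σ} → Step (skip ∥ skip) σ skip σ
  R0  : ∀ {r s h ρ} → ¬ (r ∈ρ ρ) → Step (resource r skip) (s , h , ρ) skip (s , h , ρ)
  R1  : ∀ {r C C' s h O L D s' h' ρ'} → ¬ (r ∈ρ cfg O L D) → r ∈ Locked C →
        Step C (s , h , cfg (r ∷ O) L D) C' (s' , h' , ρ') →
        Step (resource r C) (s , h , cfg O L D) (resource r C') (s' , h' , rmρ r ρ')
  R2  : ∀ {r C C' s h O L D s' h' ρ'} → ¬ (r ∈ρ cfg O L D) → ¬ (r ∈ Locked C) →
        Step C (s , h , cfg O L (r ∷ D)) C' (s' , h' , ρ') →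
        Step (resource r C) (s , h , cfg O L D) (resource r C') (s' , h' , rmρ r ρ')
  -- configuration (O, L, D ∪ {r}) with r ∉ D; read on lists: r ∈ D, remaining part rm r D
  W0  : ∀ {r B C s h O L D} → r ∈ D → ⟦ B ⟧B s ≡ true →
        Step (with' r B C) (s , h , cfg O L D) (within r C) (s , h , cfg (r ∷ O) L (rm r D))
  W1  : ∀ {r C C' s h O L D s' h' O' L' D'} → r ∈ O →
        Step C (s , h , cfg (rm r O) L D) C' (s' , h' , cfg O' L' D') →
        Step (within r C) (s , h , cfg O L D) (within r C') (s' , h' , cfg (r ∷ O') L' D')
  W2  : ∀ {r s h O L D} → r ∈ O →
        Step (within r skip) (s , h , cfg O L D) skip (s , h , cfg (rm r O) L (r ∷ D))
  BCT : ∀ {c s h ρ s' h'} → BasicStep c s h s' h' →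
        Step (basic c) (s , h , ρ) skip (s' , h' , ρ)

data Abort : Cmd → State → Set where
  RA   : ∀ {r C s h ρ} → r ∈ρ ρ → Abort (resource r C) (s , h , ρ)
  WA   : ∀ {r B C s h ρ} → ¬ (r ∈ρ ρ) → Abort (with' r B C) (s , h , ρ)
  RA1  : ∀ {r C s h O L D} → ¬ (r ∈ρ cfg O L D) → r ∈ Locked C →
         Abort C (s , h , cfg (r ∷ O) L D) → Abort (resource r C) (s , h , cfg O L D)
  RA2  : ∀ {r C s h O L D} → ¬ (r ∈ρ cfg O L D) → ¬ (r ∈ Locked C) →
         Abort C (s , h , cfg O L (r ∷ D)) → Abort (resource r C) (s , h , cfg O L D)
  BCA  : ∀ {c s h ρ} → BasicAbort c s h → Abort (basic c) (s , h , ρ)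
  SA   : ∀ {C₁ C₂ σ} → Abort C₁ σ → Abort (C₁ ︔ C₂) σ
  WA1  : ∀ {r C s h ρ} → Abort C (s , h , rmρ r ρ) → Abort (within r C) (s , h , ρ)
  WA2  : ∀ {r C s h O L D} → ¬ (r ∈ O) → Abort (within r C) (s , h , cfg O L D)
  PA1  : ∀ {C₁ C₂ σ} → Abort C₁ σ → Abort (C₁ ∥ C₂) σ
  PA2  : ∀ {C₁ C₂ σ} → Abort C₂ σ → Abort (C₁ ∥ C₂) σ

data Steps : ℕ → Cmd → State → Cmd → State → Set where
  done : ∀ {C σ} → Steps zero C σ C σ
  more : ∀ {k C σ C' σ' C'' σ''} → Step C σ C' σ' → Steps k C' σ' C'' σ'' →
         Steps (suc k) C σ C'' σ''

-- C,σ →_p^j abort   (j−1 program steps followed by an aborting step)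
AbortsIn : ℕ → Cmd → State → Set
AbortsIn zero    C σ = ⊥
AbortsIn (suc i) C σ = Σ Cmd λ C'' → Σ State λ σ'' → Steps i C σ C'' σ'' × Abort C'' σ''

Reachable : Cmd → Set
Reachable C' = Σ Cmd λ C₀ → Unextended C₀ × (Σ State λ σ → Σ State λ σ' → Σ ℕ λ k →
               Steps k C₀ σ C' σ' × (∀ j → j ℕ.≤ k → ¬ AbortsIn j C₀ σ))

EnvStep : VarSet → Ctx → Cmd → State → State → Set₁
EnvStep A Γ C (s , ĥ , cfg O L D) (s' , ĥ' , cfg O' L' D') =
  Σ Heap λ h → Σ Heap λ hG → Σ Heap λ hG' →
    h ⊥H hG × ĥ ≈H (h ⊎H hG) × h ⊥H hG' × ĥ' ≈H (h ⊎H hG') ×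
    (∀ x → (A x ⊎ (Σ ResName λ r → r ∈ Locked C × PV Γ r x)) → s x ≡ s' x) ×
    O' ≐ O × (L' ++ D') ≐ (L ++ D) × ValidConfig (cfg O' L' D') ×
    Star s hG Γ D × Star s' hG' Γ D'

data Trans (A : VarSet) (Γ : Ctx) : Cmd → State → Cmd → State → Set₁ where
  prog : ∀ {C σ C' σ'} → Step C σ C' σ' → Trans A Γ C σ C' σ'
  env  : ∀ {C σ σ'} → EnvStep A Γ C σ σ' → Trans A Γ C σ C σ'

Safe : ℕ → Cmd → Store → Heap → Config → Ctx → Assn → VarSet → Set₁
Safe zero    C s h ρ Γ Q A = ⊤₁
Safe (suc n) C s h (cfg O L D) Γ Q A =
  (C ≡ skip → (s , h) ⊨ Q)
  × ¬ Abort C (s , h , cfg O L D)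
  × (∀ x → Chng x C → ∀ r → r ∈ L ++ D → PV Γ r x → ⊥)
  × (∀ hG → hG ⊥H h → Star s hG Γ D →
       ∀ C' s' ĥ ρ' → Trans A Γ C (s , h ⊎H hG , cfg O L D) C' (s' , ĥ , ρ') →
       Σ Heap λ h' → Σ Heap λ hG' →
         h' ⊥H hG' × ĥ ≈H (h' ⊎H hG') × Star s' hG' Γ (Config.D ρ') × Safe n C' s' h' ρ' Γ Q A)

-- Renaming r to a fresh r' agrees, on every name that occurs, with the transposition (r r').
-- Since a transposition is a bijection of resource names, it suffices that the whole
-- semantics (program steps, aborts, the invariant ⊛, protected variables, environment
-- steps) is invariant under a bijective renaming of resource names applied simultaneously
-- to command, configuration and context; safety then transfers back along the bijection
-- by induction on n.
module Submission where

open import Defs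
open import Data.Nat using (ℕ; zero; suc; _≟_)
open import Data.Bool using (true; false; if_then_else_)
open import Data.List using ([]; _∷_; _++_; map)
open import Data.List.Membership.Propositional using (_∈_)
open import Data.List.Membership.Propositional.Properties using (∈-map⁺; ∈-map⁻)
import Data.List.Membership.DecPropositional as DecMembership
open import Data.List.Properties using (map-++; map-cong-local; filter-accept; filter-reject)
open import Data.List.Relation.Unary.All as All using ()
open import Data.List.Relation.Unary.Any as Any using (here; there)
import Data.List.Relation.Unary.Any.Properties as Any
open import Data.Product as Product using (Σ; _×_; _,_; proj₁; proj₂)
open import Data.Sum as Sum using (_⊎_; inj₁; inj₂)
open import Function using (_∘_; mk⇔)
open import Relation.Nullary using (¬_; does; ¬?; yes; no)
open import Relation.Nullary.Decidable using (dec-true; dec-false; does-⇔)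
open import Relation.Binary.PropositionalEquality
  using (_≡_; _≢_; refl; sym; trans; cong; cong₂; subst; subst₂; module ≡-Reasoning)

open DecMembership _≟_ using (_∈?_)
open ≡-Reasoning

mapC : (ResName → ResName) → Cmd → Cmd
mapC f skip           = skip
mapC f (basic c)      = basic c
mapC f (C₁ ︔ C₂)      = mapC f C₁ ︔ mapC f C₂
mapC f (ifte b C₁ C₂) = ifte b (mapC f C₁) (mapC f C₂)
mapC f (while b C)    = while b (mapC f C)
mapC f (resource a C) = resource (f a) (mapC f C)
mapC f (with' a b C)  = with' (f a) b (mapC f C)
mapC f (C₁ ∥ C₂)      = mapC f C₁ ∥ mapC f C₂
mapC f (within a C)   = within (f a) (mapC f C)

mapρ : (ResName → ResName) → Config → Config
mapρ f (cfg O L D) = cfg (map f O) (map f L) (map f D)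

mapΓ : (ResName → ResName) → Ctx → Ctx
mapΓ f = map (λ e → entry (f (name e)) (prot e) (inv e))

mapσ : (ResName → ResName) → State → State
mapσ f (s , h , ρ) = s , h , mapρ f ρ

renC≡mapC : ∀ r' r C → renC r' r C ≡ mapC (ren r' r) C
renC≡mapC r' r skip           = refl
renC≡mapC r' r (basic c)      = refl
renC≡mapC r' r (C₁ ︔ C₂)      = cong₂ _︔_ (renC≡mapC r' r C₁) (renC≡mapC r' r C₂)
renC≡mapC r' r (ifte b C₁ C₂) = cong₂ (ifte b) (renC≡mapC r' r C₁) (renC≡mapC r' r C₂)
renC≡mapC r' r (while b C)    = cong (while b) (renC≡mapC r' r C)
renC≡mapC r' r (resource a C) = cong (resource _) (renC≡mapC r' r C)
renC≡mapC r' r (with' a b C)  = cong (with' _ b) (renC≡mapC r' r C)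
renC≡mapC r' r (C₁ ∥ C₂)      = cong₂ _∥_ (renC≡mapC r' r C₁) (renC≡mapC r' r C₂)
renC≡mapC r' r (within a C)   = cong (within _) (renC≡mapC r' r C)

mapC-cong-local : ∀ {f g} C → (∀ {a} → ResC a C → f a ≡ g a) → mapC f C ≡ mapC g C
mapC-cong-local skip           f≗g = refl
mapC-cong-local (basic c)      f≗g = refl
mapC-cong-local (C₁ ︔ C₂)      f≗g =
  cong₂ _︔_ (mapC-cong-local C₁ (f≗g ∘ inj₁)) (mapC-cong-local C₂ (f≗g ∘ inj₂))
mapC-cong-local (ifte b C₁ C₂) f≗g =
  cong₂ (ifte b) (mapC-cong-local C₁ (f≗g ∘ inj₁)) (mapC-cong-local C₂ (f≗g ∘ inj₂))
mapC-cong-local (while b C)    f≗g = cong (while b) (mapC-cong-local C f≗g)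
mapC-cong-local (resource a C) f≗g =
  cong₂ resource (f≗g (inj₁ refl)) (mapC-cong-local C (f≗g ∘ inj₂))
mapC-cong-local (with' a b C)  f≗g =
  cong₂ (λ a' C' → with' a' b C') (f≗g (inj₁ refl)) (mapC-cong-local C (f≗g ∘ inj₂))
mapC-cong-local (C₁ ∥ C₂)      f≗g =
  cong₂ _∥_ (mapC-cong-local C₁ (f≗g ∘ inj₁)) (mapC-cong-local C₂ (f≗g ∘ inj₂))
mapC-cong-local (within a C)   f≗g =
  cong₂ within (f≗g (inj₁ refl)) (mapC-cong-local C (f≗g ∘ inj₂))

map-cong-∈ : ∀ {f g : ResName → ResName} xs → (∀ {a} → a ∈ xs → f a ≡ g a) → map f xs ≡ map g xs
map-cong-∈ xs f≗g = map-cong-local (All.tabulate f≗g)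

mapρ-cong-local : ∀ {f g} ρ → (∀ {a} → a ∈ρ ρ → f a ≡ g a) → mapρ f ρ ≡ mapρ g ρ
mapρ-cong-local (cfg O L D) f≗g =
  cong₂ (λ O' LD' → cfg O' (proj₁ LD') (proj₂ LD')) (map-cong-∈ O (f≗g ∘ inj₁))
    (cong₂ _,_ (map-cong-∈ L (f≗g ∘ inj₂ ∘ inj₁)) (map-cong-∈ D (f≗g ∘ inj₂ ∘ inj₂)))

mapΓ-cong-local : ∀ {f g} Γ → (∀ {a} → a ∈ ResΓ Γ → f a ≡ g a) → mapΓ f Γ ≡ mapΓ g Γ
mapΓ-cong-local []      f≗g = refl
mapΓ-cong-local (e ∷ Γ) f≗g =
  cong₂ (λ a Γ' → entry a (prot e) (inv e) ∷ Γ') (f≗g (here refl))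
    (mapΓ-cong-local Γ (f≗g ∘ there))

module Permuted (π π⁻¹ : ResName → ResName)
                (π-π⁻¹ : ∀ a → π (π⁻¹ a) ≡ a) (π⁻¹-π : ∀ a → π⁻¹ (π a) ≡ a) where

  π≡⇒≡π⁻¹ : ∀ {a b} → π a ≡ b → a ≡ π⁻¹ b
  π≡⇒≡π⁻¹ {a} πa≡b = trans (sym (π⁻¹-π a)) (cong π⁻¹ πa≡b)

  π-injective : ∀ {a b} → π a ≡ π b → a ≡ b
  π-injective {b = b} πa≡πb = trans (π≡⇒≡π⁻¹ πa≡πb) (π⁻¹-π b)

  ∈-map-π⁻ : ∀ {a xs} → π a ∈ map π xs → a ∈ xs
  ∈-map-π⁻ πa∈ with b , b∈ , πa≡πb ← ∈-map⁻ π πa∈ = subst (_∈ _) (sym (π-injective πa≡πb)) b∈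

  ∈-map-π⁻¹ : ∀ {a xs} → a ∈ map π xs → π⁻¹ a ∈ xs
  ∈-map-π⁻¹ {a} a∈ = ∈-map-π⁻ (subst (_∈ _) (sym (π-π⁻¹ a)) a∈)

  ∈-map-π⁺ : ∀ {a xs} → π⁻¹ a ∈ xs → a ∈ map π xs
  ∈-map-π⁺ {a} a∈ = subst (_∈ _) (π-π⁻¹ a) (∈-map⁺ π a∈)

  ∈ρ-mapρ⁺ : ∀ {a ρ} → a ∈ρ ρ → π a ∈ρ mapρ π ρ
  ∈ρ-mapρ⁺ = Sum.map (∈-map⁺ π) (Sum.map (∈-map⁺ π) (∈-map⁺ π))

  ∈ρ-mapρ⁻ : ∀ {a ρ} → π a ∈ρ mapρ π ρ → a ∈ρ ρ
  ∈ρ-mapρ⁻ = Sum.map ∈-map-π⁻ (Sum.map ∈-map-π⁻ ∈-map-π⁻)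

  rm-map : ∀ a xs → rm (π a) (map π xs) ≡ map π (rm a xs)
  rm-map a []       = refl
  rm-map a (b ∷ xs) with b ≟ a
  ... | yes b≡a = begin
    rm (π a) (π b ∷ map π xs) ≡⟨ filter-reject (λ c → ¬? (c ≟ π a)) (λ πb≢πa → πb≢πa (cong π b≡a)) ⟩
    rm (π a) (map π xs)       ≡⟨ rm-map a xs ⟩
    map π (rm a xs)           ≡⟨ cong (map π) (filter-reject (λ c → ¬? (c ≟ a)) (λ b≢a → b≢a b≡a)) ⟨
    map π (rm a (b ∷ xs))     ∎
  ... | no b≢a = begin
    rm (π a) (π b ∷ map π xs) ≡⟨ filter-accept (λ c → ¬? (c ≟ π a)) (b≢a ∘ π-injective) ⟩
    π b ∷ rm (π a) (map π xs) ≡⟨ cong (π b ∷_) (rm-map a xs) ⟩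
    map π (b ∷ rm a xs)       ≡⟨ cong (map π) (filter-accept (λ c → ¬? (c ≟ a)) b≢a) ⟨
    map π (rm a (b ∷ xs))     ∎

  rmρ-mapρ : ∀ a ρ → rmρ (π a) (mapρ π ρ) ≡ mapρ π (rmρ a ρ)
  rmρ-mapρ a (cfg O L D) = cong₂ (λ O' LD' → cfg O' (proj₁ LD') (proj₂ LD')) (rm-map a O)
    (cong₂ _,_ (rm-map a L) (rm-map a D))

  Locked-mapC : ∀ C → Locked (mapC π C) ≡ map π (Locked C)
  Locked-mapC skip           = refl
  Locked-mapC (basic _)      = refl
  Locked-mapC (C₁ ︔ C₂)      = Locked-mapC C₁
  Locked-mapC (ifte _ _ _)   = refl
  Locked-mapC (while _ _)    = refl
  Locked-mapC (resource a C) = trans (cong (rm (π a)) (Locked-mapC C)) (rm-map a (Locked C))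
  Locked-mapC (with' _ _ _)  = refl
  Locked-mapC (C₁ ∥ C₂)      =
    trans (cong₂ _++_ (Locked-mapC C₁) (Locked-mapC C₂)) (sym (map-++ π (Locked C₁) (Locked C₂)))
  Locked-mapC (within a C)   = cong (π a ∷_) (Locked-mapC C)

  ∈-Locked-mapC⁺ : ∀ {a} C → a ∈ Locked C → π a ∈ Locked (mapC π C)
  ∈-Locked-mapC⁺ C a∈ = subst (_ ∈_) (sym (Locked-mapC C)) (∈-map⁺ π a∈)

  ∈-Locked-mapC⁻ : ∀ {a} C → a ∈ Locked (mapC π C) → π⁻¹ a ∈ Locked C
  ∈-Locked-mapC⁻ C a∈ = ∈-map-π⁻¹ (subst (_ ∈_) (Locked-mapC C) a∈)

  ∉-Locked-mapC : ∀ {a} C → ¬ a ∈ Locked C → ¬ π a ∈ Locked (mapC π C)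
  ∉-Locked-mapC {a} C a∉ πa∈ = a∉ (subst (_∈ _) (π⁻¹-π a) (∈-Locked-mapC⁻ C πa∈))

  Step-mapC : ∀ {C σ C' σ'} → Step C σ C' σ' → Step (mapC π C) (mapσ π σ) (mapC π C') (mapσ π σ')
  Step-mapC S1         = S1
  Step-mapC (S2 st)    = S2 (Step-mapC st)
  Step-mapC LP         = LP
  Step-mapC (IF1 b)    = IF1 b
  Step-mapC (IF2 b)    = IF2 b
  Step-mapC (P1 st)    = P1 (Step-mapC st)
  Step-mapC (P2 st)    = P2 (Step-mapC st)
  Step-mapC P3         = P3
  Step-mapC (R0 a∉)    = R0 (a∉ ∘ ∈ρ-mapρ⁻)
  Step-mapC (R1 {r = a} {C = C} {ρ' = ρ'} a∉ a∈ st) =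
    subst (λ ρ'' → Step _ _ _ (_ , _ , ρ'')) (rmρ-mapρ a ρ')
      (R1 (a∉ ∘ ∈ρ-mapρ⁻) (∈-Locked-mapC⁺ C a∈) (Step-mapC st))
  Step-mapC (R2 {r = a} {C = C} {ρ' = ρ'} a∉ a∉L st) =
    subst (λ ρ'' → Step _ _ _ (_ , _ , ρ'')) (rmρ-mapρ a ρ')
      (R2 (a∉ ∘ ∈ρ-mapρ⁻) (∉-Locked-mapC C a∉L) (Step-mapC st))
  Step-mapC (W0 {r = a} {D = D} a∈ b) =
    subst (λ D' → Step _ _ _ (_ , _ , cfg _ _ D')) (rm-map a D) (W0 (∈-map⁺ π a∈) b)
  Step-mapC (W1 {r = a} {O = O} a∈ st) =
    W1 (∈-map⁺ π a∈) (subst (λ O' → Step _ (_ , _ , cfg O' _ _) _ _) (sym (rm-map a O)) (Step-mapC st))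
  Step-mapC (W2 {r = a} {O = O} a∈) =
    subst (λ O' → Step _ _ _ (_ , _ , cfg O' _ _)) (rm-map a O) (W2 (∈-map⁺ π a∈))
  Step-mapC (BCT b)    = BCT b

  Abort-mapC : ∀ {C σ} → Abort C σ → Abort (mapC π C) (mapσ π σ)
  Abort-mapC (RA a∈)           = RA (∈ρ-mapρ⁺ a∈)
  Abort-mapC (WA a∉)           = WA (a∉ ∘ ∈ρ-mapρ⁻)
  Abort-mapC (RA1 {C = C} a∉ a∈ ab) = RA1 (a∉ ∘ ∈ρ-mapρ⁻) (∈-Locked-mapC⁺ C a∈) (Abort-mapC ab)
  Abort-mapC (RA2 {C = C} a∉ a∉L ab) = RA2 (a∉ ∘ ∈ρ-mapρ⁻) (∉-Locked-mapC C a∉L) (Abort-mapC ab)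
  Abort-mapC (BCA b)           = BCA b
  Abort-mapC (SA ab)           = SA (Abort-mapC ab)
  Abort-mapC (WA1 {r = a} {ρ = ρ} ab) =
    WA1 (subst (λ ρ' → Abort _ (_ , _ , ρ')) (sym (rmρ-mapρ a ρ)) (Abort-mapC ab))
  Abort-mapC (WA2 a∉)          = WA2 (a∉ ∘ ∈-map-π⁻)
  Abort-mapC (PA1 ab)          = PA1 (Abort-mapC ab)
  Abort-mapC (PA2 ab)          = PA2 (Abort-mapC ab)

  does-∈-map : ∀ a xs → does (π a ∈? map π xs) ≡ does (a ∈? xs)
  does-∈-map a xs = does-⇔ (mk⇔ ∈-map-π⁻ (∈-map⁺ π)) (π a ∈? map π xs) (a ∈? xs)

  Star-mapΓ⁺ : ∀ {s h} Γ D → Star s h Γ D → Star s h (mapΓ π Γ) (map π D)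
  Star-mapΓ⁺ []      D st = st
  Star-mapΓ⁺ (e ∷ Γ) D st rewrite does-∈-map (name e) D with does (name e ∈? D)
  Star-mapΓ⁺ (e ∷ Γ) D (h₁ , h₂ , h₁⊥h₂ , h≈ , Rh₁ , st) | true  =
    h₁ , h₂ , h₁⊥h₂ , h≈ , Rh₁ , Star-mapΓ⁺ Γ D st
  Star-mapΓ⁺ (e ∷ Γ) D st                                | false = Star-mapΓ⁺ Γ D st

  Star-mapΓ⁻ : ∀ {s h} Γ D → Star s h (mapΓ π Γ) (map π D) → Star s h Γ D
  Star-mapΓ⁻ []      D st = st
  Star-mapΓ⁻ (e ∷ Γ) D st rewrite does-∈-map (name e) D with does (name e ∈? D)
  Star-mapΓ⁻ (e ∷ Γ) D (h₁ , h₂ , h₁⊥h₂ , h≈ , Rh₁ , st) | true  =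
    h₁ , h₂ , h₁⊥h₂ , h≈ , Rh₁ , Star-mapΓ⁻ Γ D st
  Star-mapΓ⁻ (e ∷ Γ) D st                                | false = Star-mapΓ⁻ Γ D st

  PV-mapΓ⁺ : ∀ {Γ a x} → PV Γ a x → PV (mapΓ π Γ) (π a) x
  PV-mapΓ⁺ = Any.map⁺ ∘ Any.map (Product.map₁ (cong π))

  PV-mapΓ⁻ : ∀ {Γ a x} → PV (mapΓ π Γ) a x → PV Γ (π⁻¹ a) x
  PV-mapΓ⁻ = Any.map (Product.map₁ π≡⇒≡π⁻¹) ∘ Any.map⁻

  Chng-mapC : ∀ {x} C → Chng x C → Chng x (mapC π C)
  Chng-mapC (basic (assign _ _)) x∈ = x∈
  Chng-mapC (basic (load _ _))   x∈ = x∈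
  Chng-mapC (basic (consC _ _))  x∈ = x∈
  Chng-mapC (C₁ ︔ C₂)            x∈ = Chng-mapC C₁ x∈
  Chng-mapC (C₁ ∥ C₂)            x∈ = Sum.map (Chng-mapC C₁) (Chng-mapC C₂) x∈
  Chng-mapC (resource _ C)       x∈ = Chng-mapC C x∈
  Chng-mapC (within _ C)         x∈ = Chng-mapC C x∈

  ≐-map : ∀ {xs ys} → xs ≐ ys → map π xs ≐ map π ys
  ≐-map xs≐ys a =
    ∈-map-π⁺ ∘ proj₁ (xs≐ys (π⁻¹ a)) ∘ ∈-map-π⁻¹ , ∈-map-π⁺ ∘ proj₂ (xs≐ys (π⁻¹ a)) ∘ ∈-map-π⁻¹

  ValidConfig-mapρ : ∀ {ρ} → ValidConfig ρ → ValidConfig (mapρ π ρ)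
  ValidConfig-mapρ valid a with valid (π⁻¹ a)
  ... | O∩L , O∩D , L∩D =
    (λ p q → O∩L (∈-map-π⁻¹ p) (∈-map-π⁻¹ q)) ,
    (λ p q → O∩D (∈-map-π⁻¹ p) (∈-map-π⁻¹ q)) ,
    (λ p q → L∩D (∈-map-π⁻¹ p) (∈-map-π⁻¹ q))

  EnvStep-map : ∀ {A Γ C s ĥ ρ s' ĥ' ρ'} → EnvStep A Γ C (s , ĥ , ρ) (s' , ĥ' , ρ') →
                EnvStep A (mapΓ π Γ) (mapC π C) (s , ĥ , mapρ π ρ) (s' , ĥ' , mapρ π ρ')
  EnvStep-map {A} {Γ} {C} {s} {ρ = cfg O L D} {s'} {ρ' = cfg O' L' D'}
    (h , hG , hG' , h⊥hG , ĥ≈ , h⊥hG' , ĥ'≈ , unchanged , O'≐O , L'D'≐LD , valid , inv , inv') =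
    h , hG , hG' , h⊥hG , ĥ≈ , h⊥hG' , ĥ'≈ , unchanged-mapped , ≐-map O'≐O ,
    subst₂ _≐_ (map-++ π L' D') (map-++ π L D) (≐-map L'D'≐LD) , ValidConfig-mapρ valid ,
    Star-mapΓ⁺ Γ D inv , Star-mapΓ⁺ Γ D' inv'
    where
    unchanged-mapped : ∀ x → A x ⊎ Σ ResName (λ a → a ∈ Locked (mapC π C) × PV (mapΓ π Γ) a x) →
                       s x ≡ s' x
    unchanged-mapped x (inj₁ x∈A)              = unchanged x (inj₁ x∈A)
    unchanged-mapped x (inj₂ (a , a∈ , x∈PV)) =
      unchanged x (inj₂ (π⁻¹ a , ∈-Locked-mapC⁻ C a∈ , PV-mapΓ⁻ x∈PV))

  Trans-map : ∀ {A Γ C σ C' σ'} → Trans A Γ C σ C' σ' →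
              Trans A (mapΓ π Γ) (mapC π C) (mapσ π σ) (mapC π C') (mapσ π σ')
  Trans-map (prog st) = prog (Step-mapC st)
  Trans-map {σ = s , ĥ , ρ} {σ' = s' , ĥ' , ρ'} (env {C = C} ev) =
    env (EnvStep-map {C = C} {s} {ĥ} {ρ} {s'} {ĥ'} {ρ'} ev)

  Safe-map⁻ : ∀ {Γ Q A} n C s h ρ → Safe n (mapC π C) s h (mapρ π ρ) (mapΓ π Γ) Q A → Safe n C s h ρ Γ Q A
  Safe-map⁻ zero    C s h ρ           _ = _
  Safe-map⁻ {Γ} (suc n) C s h (cfg O L D) (skip⇒Q , ¬abort , chng-unprotected , steps) =
    skip⇒Q ∘ cong (mapC π) ,
    ¬abort ∘ Abort-mapC ,
    (λ x x∈ a a∈LD x∈PV → chng-unprotected x (Chng-mapC C x∈) (π a)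
       (subst (π a ∈_) (map-++ π L D) (∈-map⁺ π a∈LD)) (PV-mapΓ⁺ x∈PV)) ,
    λ hG hG⊥h inv C' s' ĥ ρ' t →
      let h' , hG' , h'⊥hG' , ĥ≈ , inv' , safe' =
            steps hG hG⊥h (Star-mapΓ⁺ Γ D inv) (mapC π C') s' ĥ (mapρ π ρ') (Trans-map t)
      in h' , hG' , h'⊥hG' , ĥ≈ , Star-mapΓ⁻ Γ (Config.D ρ') inv' , Safe-map⁻ n C' s' h' ρ' safe'

swap : ResName → ResName → ResName → ResName
swap r r' a = if does (a ≟ r) then r' else if does (a ≟ r') then r else a

swap-at-r : ∀ r r' → swap r r' r ≡ r'
swap-at-r r r' rewrite dec-true (r ≟ r) refl = refl

swap-at-r' : ∀ r r' → swap r r' r' ≡ r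
swap-at-r' r r' with r' ≟ r
... | yes r'≡r rewrite dec-true (r' ≟ r) r'≡r = r'≡r
... | no r'≢r rewrite dec-false (r' ≟ r) r'≢r | dec-true (r' ≟ r') refl = refl

swap-elsewhere : ∀ {r r' a} → a ≢ r → a ≢ r' → swap r r' a ≡ a
swap-elsewhere {r} {r'} {a} a≢r a≢r' rewrite dec-false (a ≟ r) a≢r | dec-false (a ≟ r') a≢r' = refl

swap-involutive : ∀ r r' a → swap r r' (swap r r' a) ≡ a
swap-involutive r r' a with a ≟ r | a ≟ r'
... | yes refl | _        = trans (cong (swap a r') (swap-at-r a r')) (swap-at-r' a r')
... | no _     | yes refl = trans (cong (swap r a) (swap-at-r' r a)) (swap-at-r r a)
... | no a≢r   | no a≢r'  = trans (cong (swap r r') fixed) fixed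
  where fixed = swap-elsewhere a≢r a≢r'

ren≡swap : ∀ r r' {a} → a ≢ r' → ren r' r a ≡ swap r r' a
ren≡swap r r' {a} a≢r' with does (a ≟ r)
... | true  = refl
... | false rewrite dec-false (a ≟ r') a≢r' = refl

proposition16 : (n : ℕ) (C : Cmd) (s : Store) (h : Heap) (ρ : Config)
    (Q : Assn) (A : VarSet) (Γ : Ctx) (r r' : ResName) →
    Reachable C → IsResCtx Γ → ValidConfig ρ →
    ¬ ResC r' C → ¬ (r' ∈ ResΓ Γ) →
    (∀ x → (x ∈ρ ρ → x ∈ ResΓ Γ) × (x ∈ ResΓ Γ → x ∈ρ ρ)) →
    Safe n (renC r' r C) s h (renρ r' r ρ) (renΓ r' r Γ) Q A →
    Safe n C s h ρ Γ Q A
proposition16 n C s h ρ Q A Γ r r' _ _ _ r'∉C r'∉Γ ρ≐Γ safe = Safe-map⁻ n C s h ρ swapped-safe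
  where
  open Permuted (swap r r') (swap r r') (swap-involutive r r') (swap-involutive r r')

  renC-is-swap : renC r' r C ≡ mapC (swap r r') C
  renC-is-swap = trans (renC≡mapC r' r C)
    (mapC-cong-local C λ {a} a∈C → ren≡swap r r' {a} λ { refl → r'∉C a∈C })

  renρ-is-swap : renρ r' r ρ ≡ mapρ (swap r r') ρ
  renρ-is-swap =
    mapρ-cong-local ρ λ {a} a∈ρ → ren≡swap r r' {a} λ { refl → r'∉Γ (proj₁ (ρ≐Γ _) a∈ρ) }

  renΓ-is-swap : renΓ r' r Γ ≡ mapΓ (swap r r') Γ
  renΓ-is-swap = mapΓ-cong-local Γ λ {a} a∈Γ → ren≡swap r r' {a} λ { refl → r'∉Γ a∈Γ }

  swapped-safe : Safe n (mapC (swap r r') C) s h (mapρ (swap r r') ρ) (mapΓ (swap r r') Γ) Q A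
  swapped-safe = subst (λ C' → Safe n C' s h _ _ Q A) renC-is-swap
    (subst₂ (λ ρ' Γ' → Safe n _ s h ρ' Γ' Q A) renρ-is-swap renΓ-is-swap safe)
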